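{- For all $\Gamma\cup\{\phi\}\subseteq\mathcal{L}_\Delta$: $\Gamma\Vvdash_{qf}\phi$ if and only if $\Gamma\vDash\phi$. In particular, for all $\phi\in\mathcal{L}_\Delta$, $\phi$ is valid on all quasi-filter models under $\Vvdash$ iff $\phi$ is valid on all Kripke models.
   Context: $\mathcal{L}_\Delta$: $\phi::=p\mid\neg\phi\mid(\phi\land\phi)\mid\Delta\phi$. Neighborhood semantics $\Vvdash$ on $\mathcal{M}=\langle S,N,V\rangle$: $s\Vvdash p$ iff $s\in V(p)$, Boolean clauses standard, $\mathcal{M},s\Vvdash\Delta\phi$ iff $\{t:\mathcal{M},t\Vvdash\phi\}\in N(s)$. A quasi-filter model is a neighborhood model such that for every $s$: $S\in N(s)$; $N(s)$ is closed under binary intersections; $X\in N(s)$ implies $S\setminus X\in N(s)$; and for all $X,Y,Z\subseteq S$, $X\in N(s)$ implies $X\cup Y\in N(s)$ or $(S\setminus X)\cup Z\in N(s)$. $\Gamma\Vvdash_{qf}\phi$: for every quasi-filter model $\mathcal{M}$ and state $s$, if $\mathcal{M},s\Vvdash\psi$ for all $\psi\in\Gamma$ then $\mathcal{M},s\Vvdash\phi$. Kripke semantics on $\mathcal{M}=\langle S,R,V\rangle$: $\mathcal{M},s\vDash\Delta\phi$ iff for all $t,u$ with $sRt$ and $sRu$, ($\mathcal{M},t\vDash\phi$ iff $\mathcal{M},u\vDash\phi$); other clauses standard. $\Gamma\vDash\phi$: for every Kripke model and state, if all of $\Gamma$ holds then $\phi$ holds. -}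

module Defs where

open import Data.Nat using (ℕ)
open import Data.Unit using (⊤)
open import Data.Empty using (⊥)
open import Data.Product using (_×_; _,_)
open import Data.Sum using (_⊎_)
open import Relation.Nullary using (¬_)

Atom : Set
Atom = ℕ

data Form : Set where
  var : Atom → Form
  ¬'_ : Form → Form
  _∧'_ : Form → Form → Form
  Δ_ : Form → Form

Subset : Set → Set₁
Subset S = S → Set

full : {S : Set} → Subset S
full _ = ⊤

compl : {S : Set} → Subset S → Subset S
compl X t = ¬ X t

_∩_ : {S : Set} → Subset S → Subset S → Subset S
(X ∩ Y) t = X t × Y t

_∪_ : {S : Set} → Subset S → Subset S → Subset S
(X ∪ Y) t = X t ⊎ Y t

-- Neighborhood models.  Since subsets are predicates, we require the
-- neighborhood function to respect extensional equality of subsets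
-- (classically, subsets with the same elements are equal).

record NbhdModel : Set₁ where
  field
    S   : Set
    N   : S → Subset S → Set
    V   : Atom → Subset S
    N-ext : ∀ s (X Y : Subset S) →
            (∀ t → X t → Y t) → (∀ t → Y t → X t) → N s X → N s Y

module _ (M : NbhdModel) where
  open NbhdModel M
  nsat : S → Form → Set
  nsat s (var p)  = V p s
  nsat s (¬' φ)   = ¬ nsat s φ
  nsat s (φ ∧' ψ) = nsat s φ × nsat s ψ
  nsat s (Δ φ)    = N s (λ t → nsat t φ)

record IsQuasiFilter (M : NbhdModel) : Set₁ where
  open NbhdModel M
  field
    has-full  : ∀ s → N s full
    ∩-closed  : ∀ s X Y → N s X → N s Y → N s (X ∩ Y)
    compl-closed : ∀ s X → N s X → N s (compl X)
    qf-cond   : ∀ s X Y Z → N s X → N s (X ∪ Y) ⊎ N s (compl X ∪ Z)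

_⊩qf_ : (Form → Set) → Form → Set₁
Γ ⊩qf φ = ∀ (M : NbhdModel) → IsQuasiFilter M → ∀ s →
          (∀ ψ → Γ ψ → nsat M s ψ) → nsat M s φ

record KripkeModel : Set₁ where
  field
    S : Set
    R : S → S → Set
    V : Atom → Subset S

module _ (M : KripkeModel) where
  open KripkeModel M
  ksat : S → Form → Set
  ksat s (var p)  = V p s
  ksat s (¬' φ)   = ¬ ksat s φ
  ksat s (φ ∧' ψ) = ksat s φ × ksat s ψ
  ksat s (Δ φ)    = ∀ t u → R s t → R s u →
                    (ksat t φ → ksat u φ) × (ksat u φ → ksat t φ)

_⊨_ : (Form → Set) → Form → Set₁
Γ ⊨ φ = ∀ (M : KripkeModel) → ∀ s →
        (∀ ψ → Γ ψ → ksat M s ψ) → ksat M s φ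

∅ : Form → Set
∅ _ = ⊥

-- A Kripke model is a quasi-filter model once the neighbourhoods of s are taken to be the sets
-- that are constant on the successors of s, and Δ means the same in both readings.  Conversely,
-- in a quasi-filter model the sets X with X ∪ Y ∈ N(s) for every Y form a filter, and N(s)
-- consists of the sets X such that X or S ∖ X lies in that filter; so Δφ means □φ ∨ □¬φ for the
-- filter modality □, exactly as it does in every Kripke model.  A filter model agrees on modal
-- formulas with its canonical Kripke model, whose worlds are the maximal finitely satisfiable
-- sets of modal formulas, obtained by a Lindenbaum construction along an enumeration of them.

module Submission where

open import Defs
open import Level using (0ℓ)
open import Axiom.ExcludedMiddle using (ExcludedMiddle)
open import Axiom.DoubleNegationElimination using (em⇒dne)
open import Data.Bool using (Bool; false; T)
open import Data.Empty using (⊥; ⊥-elim)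
open import Data.List using (List; []; _∷_; _++_; map; cartesianProductWith)
open import Data.List.Membership.Propositional using (_∈_)
open import Data.List.Membership.Propositional.Properties
  using (∈-++⁺ˡ; ∈-++⁺ʳ; ∈-map⁺; ∈-cartesianProductWith⁺)
open import Data.List.Relation.Unary.All as All using (All; []; _∷_)
open import Data.List.Relation.Unary.All.Properties using (++⁺; ++⁻ˡ; ++⁻ʳ; map⁺; map⁻)
open import Data.List.Relation.Unary.Any using (here; there)
open import Data.Nat using (ℕ; zero; suc; _≤_; _⊔_; _≤′_; ≤′-refl; ≤′-step)
open import Data.Nat.Properties using (≤⇒≤′; m≤m⊔n; m≤n⊔m)
open import Data.Product using (Σ; ∃; _×_; _,_; proj₁; proj₂)
open import Data.Product.Function.NonDependent.Propositional using (_×-⇔_)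
open import Data.Sum using (_⊎_; inj₁; inj₂; [_,_])
import Data.Sum as Sum
open import Data.Unit using (tt)
open import Function using (_∘_; id)
open import Function.Bundles using (_⇔_; mk⇔; Equivalence)
open import Function.Construct.Composition using (_⇔-∘_)
open import Function.Properties.Equivalence using (⇔-setoid)
open import Function.Construct.Identity using (⇔-id)
open import Function.Construct.Symmetry using (⇔-sym)
open import Function.Related.TypeIsomorphisms using (→-cong-⇔)
open import Relation.Binary.PropositionalEquality using (_≡_; refl)
open import Relation.Nullary using (¬_; Dec; yes; no)
open import Relation.Nullary.Decidable using (isYes; fromWitness; toWitness; toSum)
open import Relation.Unary using (Pred; _⊆_; _≐_)
open import Relation.Unary.Properties using (≐-sym)
open import Relation.Binary.Reasoning.Setoid (⇔-setoid 0ℓ)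

open Equivalence using (to; from)

¬-cong : {A B : Set} → A ⇔ B → (¬ A) ⇔ (¬ B)
¬-cong A⇔B = →-cong-⇔ A⇔B (⇔-id ⊥)

data ModalForm : Set where
  atom : Atom → ModalForm
  ¬ₘ_  : ModalForm → ModalForm
  _∧ₘ_ : ModalForm → ModalForm → ModalForm
  □_   : ModalForm → ModalForm

infix  6 ¬ₘ_ □_
infixr 5 _∧ₘ_
infixr 4 _∨ₘ_

_∨ₘ_ : ModalForm → ModalForm → ModalForm
x ∨ₘ y = ¬ₘ (¬ₘ x ∧ₘ ¬ₘ y)

toModal : Form → ModalForm
toModal (var p)  = atom p
toModal (¬' φ)   = ¬ₘ toModal φ
toModal (φ ∧' ψ) = toModal φ ∧ₘ toModal ψ
toModal (Δ φ)    = □ toModal φ ∨ₘ □ ¬ₘ toModal φ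

stage : ℕ → List ModalForm
stage zero    = []
stage (suc k) = atom k ∷ stage k ++ map ¬ₘ_ (stage k) ++ map □_ (stage k)
                ++ cartesianProductWith _∧ₘ_ (stage k) (stage k)

stage-mono : ∀ {k n x} → k ≤ n → x ∈ stage k → x ∈ stage n
stage-mono = go ∘ ≤⇒≤′
  where
  go : ∀ {k n x} → k ≤′ n → x ∈ stage k → x ∈ stage n
  go ≤′-refl        = id
  go (≤′-step k≤n) = there ∘ ∈-++⁺ˡ ∘ go k≤n

∈-stage : ∀ x → ∃ λ k → x ∈ stage k
∈-stage (atom p) = suc p , here refl
∈-stage (¬ₘ x) =
  let k , x∈ = ∈-stage x
  in suc k , there (∈-++⁺ʳ (stage k) (∈-++⁺ˡ (∈-map⁺ ¬ₘ_ x∈)))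
∈-stage (□ x) =
  let k , x∈ = ∈-stage x
  in suc k , there (∈-++⁺ʳ (stage k) (∈-++⁺ʳ (map ¬ₘ_ (stage k)) (∈-++⁺ˡ (∈-map⁺ □_ x∈))))
∈-stage (x ∧ₘ y) =
  let i , x∈ = ∈-stage x
      j , y∈ = ∈-stage y
      k = i ⊔ j
  in suc k , there (∈-++⁺ʳ (stage k) (∈-++⁺ʳ (map ¬ₘ_ (stage k)) (∈-++⁺ʳ (map □_ (stage k))
       (∈-cartesianProductWith⁺ _∧ₘ_ (stage-mono (m≤m⊔n i j) x∈) (stage-mono (m≤n⊔m i j) y∈)))))

record FilterModel : Set₁ where
  field
    S     : Set
    Box   : S → Subset S → Set
    V     : Atom → Subset S
    □-mono : ∀ {s} {X Y : Subset S} → X ⊆ Y → Box s X → Box s Y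
    □-full : ∀ s → Box s full
    □-∩    : ∀ {s} {X Y : Subset S} → Box s X → Box s Y → Box s (X ∩ Y)

  msat : S → ModalForm → Set
  msat s (atom p) = V p s
  msat s (¬ₘ x)   = ¬ msat s x
  msat s (x ∧ₘ y) = msat s x × msat s y
  msat s (□ x)    = Box s (λ t → msat t x)

  Decided : S → Subset S → Set
  Decided s X = Box s X ⊎ Box s (compl X)

  Decided-cong : ∀ {s} {X Y : Subset S} → (∀ t → X t ⇔ Y t) → Decided s X ⇔ Decided s Y
  Decided-cong X⇔Y = mk⇔ (Sum.map (□-mono (to (X⇔Y _))) (□-mono (λ ¬x → ¬x ∘ from (X⇔Y _))))
                         (Sum.map (□-mono (from (X⇔Y _))) (□-mono (λ ¬y → ¬y ∘ to (X⇔Y _))))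

  □-all : ∀ {s} l → All (λ x → msat s (□ x)) l → Box s (λ t → All (msat t) l)
  □-all {s} [] []  = □-mono (λ _ → []) (□-full s)
  □-all (x ∷ l) (□x ∷ □l) = □-mono (λ (p , ps) → p ∷ ps) (□-∩ □x (□-all l □l))

relational : KripkeModel → FilterModel
relational K = record
  { S = S ; Box = λ s X → ∀ t → R s t → X t ; V = V
  ; □-mono = λ X⊆Y □X t r → X⊆Y (□X t r)
  ; □-full = λ _ _ _ → tt
  ; □-∩ = λ □X □Y t r → □X t r , □Y t r
  }
  where open KripkeModel K

module _ (M : NbhdModel) where
  open NbhdModel M

  N-≐ : ∀ {s} {X Y : Subset S} → X ≐ Y → N s X → N s Y
  N-≐ (X⊆Y , Y⊆X) = N-ext _ _ _ (λ _ → X⊆Y) (λ _ → Y⊆X)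

  N-cong : ∀ {s} {X Y : Subset S} → (∀ t → X t ⇔ Y t) → N s X ⇔ N s Y
  N-cong X⇔Y = mk⇔ (N-≐ (to (X⇔Y _) , from (X⇔Y _))) (N-≐ (from (X⇔Y _) , to (X⇔Y _)))

module _ (K : KripkeModel) where
  open KripkeModel K
  open FilterModel (relational K) using (Decided)

  ConstantOnSuccessors : S → Subset S → Set
  ConstantOnSuccessors s X = ∀ t u → R s t → R s u → (X t → X u) × (X u → X t)

  decided⇒constant : ∀ {s X} → Decided s X → ConstantOnSuccessors s X
  decided⇒constant (inj₁ □X)  t u rt ru = (λ _ → □X u ru) , (λ _ → □X t rt)
  decided⇒constant (inj₂ □¬X) t u rt ru = ⊥-elim ∘ □¬X t rt , ⊥-elim ∘ □¬X u ru

  kripkeNbhd : NbhdModel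
  kripkeNbhd = record
    { S = S ; N = ConstantOnSuccessors ; V = V
    ; N-ext = λ s X Y X⊆Y Y⊆X c t u rt ru →
        X⊆Y u ∘ proj₁ (c t u rt ru) ∘ Y⊆X t , X⊆Y t ∘ proj₂ (c t u rt ru) ∘ Y⊆X u
    }

  ksat⇔nsat : ∀ s φ → ksat K s φ ⇔ nsat kripkeNbhd s φ
  ksat⇔nsat s (var p)  = ⇔-id _
  ksat⇔nsat s (¬' φ)   = ¬-cong (ksat⇔nsat s φ)
  ksat⇔nsat s (φ ∧' ψ) = ksat⇔nsat s φ ×-⇔ ksat⇔nsat s ψ
  ksat⇔nsat s (Δ φ)    = N-cong kripkeNbhd (λ t → ksat⇔nsat t φ)

module Classical (em : ExcludedMiddle 0ℓ) where

  dne : {P : Set} → ¬ ¬ P → P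
  dne = em⇒dne em

  ¬[¬×¬]⇔⊎ : {A B : Set} → (¬ (¬ A × ¬ B)) ⇔ (A ⊎ B)
  ¬[¬×¬]⇔⊎ = mk⇔ (λ h → dne λ n → h (n ∘ inj₁ , n ∘ inj₂))
                 [ (λ a (¬a , _) → ¬a a) , (λ b (_ , ¬b) → ¬b b) ]

  decide : {A : Set} → Pred A 0ℓ → A → Bool
  decide P x = isYes (em {P x})

  T-decide : {A : Set} (P : Pred A 0ℓ) → (T ∘ decide P) ≐ P
  T-decide P = toWitness {a? = em} , fromWitness {a? = em}

  module _ (F : FilterModel) where
    open FilterModel F

    msat-Δ : ∀ s x → msat s (□ x ∨ₘ □ ¬ₘ x) ⇔ Decided s (λ t → msat t x)
    msat-Δ s x = ¬[¬×¬]⇔⊎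

  module _ (K : KripkeModel) where
    open KripkeModel K
    open FilterModel (relational K) using (Decided; Decided-cong; msat)

    constant⇒decided : ∀ {s X} → ConstantOnSuccessors K s X → Decided s X
    constant⇒decided {s} {X} c with em {∀ t → R s t → X t}
    ... | yes □X = inj₁ □X
    ... | no ¬□X = inj₂ λ t rt xt → ¬□X λ u ru → proj₁ (c t u rt ru) xt

    constant⇔decided : ∀ {s X} → ConstantOnSuccessors K s X ⇔ Decided s X
    constant⇔decided = mk⇔ constant⇒decided (decided⇒constant K)

    kripkeNbhd-isQuasiFilter : IsQuasiFilter (kripkeNbhd K)
    kripkeNbhd-isQuasiFilter = record
      { has-full = λ _ _ _ _ _ → id , id
      ; ∩-closed = λ s X Y cX cY t u rt ru →
          let xt⇒xu , xu⇒xt = cX t u rt ru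
              yt⇒yu , yu⇒yt = cY t u rt ru
          in (λ (x , y) → xt⇒xu x , yt⇒yu y) , (λ (x , y) → xu⇒xt x , yu⇒yt y)
      ; compl-closed = λ s X c t u rt ru →
          (λ ¬xt → ¬xt ∘ proj₂ (c t u rt ru)) , (λ ¬xu → ¬xu ∘ proj₁ (c t u rt ru))
      ; qf-cond = λ s X Y Z c → Sum.map (λ □X → decided⇒constant K (inj₁ λ t r → inj₁ (□X t r)))
                                        (λ □¬X → decided⇒constant K (inj₁ λ t r → inj₁ (□¬X t r)))
                                        (constant⇒decided c)
      }

    ksat⇔msat : ∀ s φ → ksat K s φ ⇔ msat s (toModal φ)
    ksat⇔msat s (var p)  = ⇔-id _
    ksat⇔msat s (¬' φ)   = ¬-cong (ksat⇔msat s φ)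
    ksat⇔msat s (φ ∧' ψ) = ksat⇔msat s φ ×-⇔ ksat⇔msat s ψ
    ksat⇔msat s (Δ φ) = begin
      ConstantOnSuccessors K s (λ t → ksat K t φ) ≈⟨ constant⇔decided ⟩
      Decided s (λ t → ksat K t φ)               ≈⟨ Decided-cong (λ t → ksat⇔msat t φ) ⟩
      Decided s (λ t → msat t (toModal φ))       ≈⟨ msat-Δ (relational K) s (toModal φ) ⟨
      msat s (toModal (Δ φ))                     ∎

  module Core (M : NbhdModel) (qf : IsQuasiFilter M) where
    open NbhdModel M
    open IsQuasiFilter qf

    ⟦_⟧ : (S → Bool) → Subset S
    ⟦ Y ⟧ t = T (Y t)

    -- Enlargements range over S → Bool to keep □ᶜ in Set; by excluded middle every subset
    -- is of the form ⟦ Y ⟧ (see □ᶜ-∪).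
    □ᶜ : S → Subset S → Set
    □ᶜ s X = (Y : S → Bool) → N s (X ∪ ⟦ Y ⟧)

    □ᶜ-∪ : ∀ {s X} → □ᶜ s X → (Y : Subset S) → N s (X ∪ Y)
    □ᶜ-∪ □X Y = N-≐ M (Sum.map₂ (proj₁ (T-decide Y)) , Sum.map₂ (proj₂ (T-decide Y))) (□X (decide Y))

    □ᶜ-mono : ∀ {s} {X Y : Subset S} → X ⊆ Y → □ᶜ s X → □ᶜ s Y
    □ᶜ-mono X⊆Y □X Z = N-≐ M ([ inj₁ ∘ X⊆Y , id ] , inj₂) (□ᶜ-∪ □X (_ ∪ ⟦ Z ⟧))

    □ᶜ-full : ∀ s → □ᶜ s full
    □ᶜ-full s Y = N-≐ M ((λ _ → inj₁ tt) , (λ _ → tt)) (has-full s)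

    □ᶜ-∩ : ∀ {s} {X Y : Subset S} → □ᶜ s X → □ᶜ s Y → □ᶜ s (X ∩ Y)
    □ᶜ-∩ {s} {X} {Y} □X □Y Z =
      N-≐ M (distrib {W = ⟦ Z ⟧} , undistrib {W = ⟦ Z ⟧}) (∩-closed s _ _ (□X Z) (□Y Z))
      where
      distrib : ∀ {W : Subset S} → (X ∪ W) ∩ (Y ∪ W) ⊆ (X ∩ Y) ∪ W
      distrib (inj₁ x , inj₁ y) = inj₁ (x , y)
      distrib (inj₁ _ , inj₂ w) = inj₂ w
      distrib (inj₂ w , _)      = inj₂ w
      undistrib : ∀ {W : Subset S} → (X ∩ Y) ∪ W ⊆ (X ∪ W) ∩ (Y ∪ W)
      undistrib (inj₁ (x , y)) = inj₁ x , inj₁ y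
      undistrib (inj₂ w)       = inj₂ w , inj₂ w

    core : FilterModel
    core = record
      { S = S ; Box = □ᶜ ; V = V
      ; □-mono = □ᶜ-mono ; □-full = □ᶜ-full ; □-∩ = □ᶜ-∩ }

    open FilterModel core using (Decided; Decided-cong; msat)

    □ᶜ⇒N : ∀ {s X} → □ᶜ s X → N s X
    □ᶜ⇒N □X = N-≐ M ([ id , (λ ()) ] , inj₁) (□X (λ _ → false))

    N⇔decided : ∀ {s X} → N s X ⇔ Decided s X
    N⇔decided {s} {X} = mk⇔ N⇒decided [ □ᶜ⇒N , □ᶜ-compl⇒N ]
      where
      □ᶜ-compl⇒N : □ᶜ s (compl X) → N s X
      □ᶜ-compl⇒N = N-≐ M (dne , λ x ¬x → ¬x x) ∘ compl-closed s _ ∘ □ᶜ⇒N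
      -- If some enlargement X ∪ Y is not a neighbourhood, the quasi-filter condition makes
      -- every (S ∖ X) ∪ Z one.
      N⇒decided : N s X → Decided s X
      N⇒decided NX with em {□ᶜ s X}
      ... | yes □X = inj₁ □X
      ... | no ¬□X = inj₂ λ Z → dne λ ¬N → ¬□X λ Y →
                       [ id , (λ N¬X∪Z → ⊥-elim (¬N N¬X∪Z)) ] (qf-cond s X ⟦ Y ⟧ ⟦ Z ⟧ NX)

    nsat⇔msat : ∀ s φ → nsat M s φ ⇔ msat s (toModal φ)
    nsat⇔msat s (var p)  = ⇔-id _
    nsat⇔msat s (¬' φ)   = ¬-cong (nsat⇔msat s φ)
    nsat⇔msat s (φ ∧' ψ) = nsat⇔msat s φ ×-⇔ nsat⇔msat s ψ
    nsat⇔msat s (Δ φ) = begin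
      N s (λ t → nsat M t φ)               ≈⟨ N⇔decided ⟩
      Decided s (λ t → nsat M t φ)         ≈⟨ Decided-cong (λ t → nsat⇔msat t φ) ⟩
      Decided s (λ t → msat t (toModal φ)) ≈⟨ msat-Δ core s (toModal φ) ⟨
      msat s (toModal (Δ φ))               ∎

  module Canonical (F : FilterModel) where
    open FilterModel F

    Theory : Set₁
    Theory = Pred ModalForm 0ℓ

    FinitelySatisfiable : Theory → Set
    FinitelySatisfiable w = ∀ l → All w l → ∃ λ s → All (msat s) l

    record IsMaximal (w : Theory) : Set where
      field
        finSat   : FinitelySatisfiable w
        complete : ∀ x → w x ⊎ w (¬ₘ x)

    open IsMaximal

    finSat-antitone : ∀ {v w} → v ⊆ w → FinitelySatisfiable w → FinitelySatisfiable v
    finSat-antitone v⊆w fs l = fs l ∘ All.map v⊆w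

    isMaximal-≐ : ∀ {v w} → v ≐ w → IsMaximal v → IsMaximal w
    isMaximal-≐ (v⊆w , w⊆v) mv = record
      { finSat = finSat-antitone w⊆v (finSat mv)
      ; complete = Sum.map v⊆w v⊆w ∘ complete mv }

    consequence : ∀ {w} → IsMaximal w → ∀ {l x} → All w l →
                  (∀ s → All (msat s) l → msat s x) → w x
    consequence mw {l} {x} wl l⊨x with complete mw x
    ... | inj₁ wx  = wx
    ... | inj₂ w¬x with finSat mw (¬ₘ x ∷ l) (w¬x ∷ wl)
    ... | s , ¬x ∷ sl = ⊥-elim (¬x (l⊨x s sl))

    ¬-both : ∀ {w} → IsMaximal w → ∀ {x} → w x → ¬ w (¬ₘ x)
    ¬-both mw wx w¬x with finSat mw (_ ∷ _ ∷ []) (wx ∷ w¬x ∷ [])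
    ... | s , x ∷ ¬x ∷ [] = ¬x x

    ¬⇔¬ₘ : ∀ {w} → IsMaximal w → ∀ {x} → (¬ w x) ⇔ w (¬ₘ x)
    ¬⇔¬ₘ mw {x} = mk⇔ (λ ¬wx → [ ⊥-elim ∘ ¬wx , id ] (complete mw x))
                      (λ w¬x wx → ¬-both mw wx w¬x)

    ×⇔∧ₘ : ∀ {w} → IsMaximal w → ∀ {x y} → (w x × w y) ⇔ w (x ∧ₘ y)
    ×⇔∧ₘ mw = mk⇔ (λ (wx , wy) → consequence mw (wx ∷ wy ∷ []) λ { s (x ∷ y ∷ []) → x , y })
                   (λ w∧ → consequence mw (w∧ ∷ []) (λ { s ((x , _) ∷ []) → x })
                         , consequence mw (w∧ ∷ []) (λ { s ((_ , y) ∷ []) → y }))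

    insert : ModalForm → Theory → Theory
    insert φ w x = w x ⊎ x ≡ φ

    split-insert : ∀ {φ w} l → All (insert φ w) l →
                   ∃ λ l′ → All w l′ × (∀ s → All (msat s) l′ → msat s φ → All (msat s) l)
    split-insert [] [] = [] , [] , λ _ _ _ → []
    split-insert (x ∷ l) (inj₁ wx ∷ al) =
      let l′ , wl′ , back = split-insert l al
      in x ∷ l′ , wx ∷ wl′ , λ { s (sx ∷ sl′) sφ → sx ∷ back s sl′ sφ }
    split-insert (x ∷ l) (inj₂ refl ∷ al) =
      let l′ , wl′ , back = split-insert l al
      in l′ , wl′ , λ s sl′ sφ → sφ ∷ back s sl′ sφ

    -- If neither w ∪ {φ} nor w ∪ {¬φ} were finitely satisfiable, two finite witnesses of
    -- failure would combine into one for w.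
    finSat-insert-¬ : ∀ {φ w} → FinitelySatisfiable w → ¬ FinitelySatisfiable (insert φ w) →
                      FinitelySatisfiable (insert (¬ₘ φ) w)
    finSat-insert-¬ {φ} {w} fs ¬fsφ l al = dne λ unsat → ¬fsφ (finSat-φ unsat)
      where
      finSat-φ : ¬ (∃ λ s → All (msat s) l) → FinitelySatisfiable (insert φ w)
      finSat-φ unsat l₁ al₁ with split-insert l al | split-insert l₁ al₁
      ... | l′ , wl′ , back | l₁′ , wl₁′ , back₁ with fs (l₁′ ++ l′) (++⁺ wl₁′ wl′)
      ... | s , sl with em {msat s φ}
      ... | yes sφ = s , back₁ s (++⁻ˡ l₁′ sl) sφ
      ... | no ¬sφ = ⊥-elim (unsat (s , back s (++⁻ʳ l₁′ sl) ¬sφ))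

    extend : ∀ φ w → Dec (FinitelySatisfiable (insert φ w)) → Theory
    extend φ w (yes _) = insert φ w
    extend φ w (no _)  = insert (¬ₘ φ) w

    extend-⊇ : ∀ {φ w} d → w ⊆ extend φ w d
    extend-⊇ (yes _) = inj₁
    extend-⊇ (no _)  = inj₁

    extend-finSat : ∀ {φ w} → FinitelySatisfiable w → ∀ d → FinitelySatisfiable (extend φ w d)
    extend-finSat fs (yes fsφ) = fsφ
    extend-finSat fs (no ¬fsφ) = finSat-insert-¬ fs ¬fsφ

    extend-decides : ∀ {φ w} d → extend φ w d φ ⊎ extend φ w d (¬ₘ φ)
    extend-decides (yes _) = inj₁ (inj₂ refl)
    extend-decides (no _)  = inj₂ (inj₂ refl)

    extendAll : List ModalForm → Theory → Theory
    extendAll []      w = w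
    extendAll (φ ∷ l) w = extendAll l (extend φ w em)

    extendAll-⊇ : ∀ l {w} → w ⊆ extendAll l w
    extendAll-⊇ []      = id
    extendAll-⊇ (φ ∷ l) = extendAll-⊇ l ∘ extend-⊇ em

    extendAll-finSat : ∀ l {w} → FinitelySatisfiable w → FinitelySatisfiable (extendAll l w)
    extendAll-finSat []      fs = fs
    extendAll-finSat (φ ∷ l) fs = extendAll-finSat l (extend-finSat fs em)

    extendAll-decides : ∀ l {w x} → x ∈ l → extendAll l w x ⊎ extendAll l w (¬ₘ x)
    extendAll-decides (φ ∷ l) (here refl) =
      Sum.map (extendAll-⊇ l) (extendAll-⊇ l) (extend-decides em)
    extendAll-decides (φ ∷ l) (there x∈l) = extendAll-decides l x∈l

    module Lindenbaum (A : Theory) (fsA : FinitelySatisfiable A) where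
      chain : ℕ → Theory
      chain zero    = A
      chain (suc k) = extendAll (stage k) (chain k)

      chain-mono : ∀ {k n} → k ≤ n → chain k ⊆ chain n
      chain-mono = go ∘ ≤⇒≤′
        where
        go : ∀ {k n} → k ≤′ n → chain k ⊆ chain n
        go ≤′-refl        = id
        go (≤′-step {n} k≤n) = extendAll-⊇ (stage n) ∘ go k≤n

      chain-finSat : ∀ k → FinitelySatisfiable (chain k)
      chain-finSat zero    = fsA
      chain-finSat (suc k) = extendAll-finSat (stage k) (chain-finSat k)

      limit : Theory
      limit x = ∃ λ k → chain k x

      limit-finite : ∀ {l} → All limit l → ∃ λ k → All (chain k) l
      limit-finite []              = 0 , []
      limit-finite ((k , x) ∷ al) =
        let n , al′ = limit-finite al
        in k ⊔ n , chain-mono (m≤m⊔n k n) x ∷ All.map (chain-mono (m≤n⊔m k n)) al′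

      limit-isMaximal : IsMaximal limit
      limit-isMaximal = record
        { finSat = λ l al → let k , al′ = limit-finite al in chain-finSat k l al′
        ; complete = λ x → let k , x∈ = ∈-stage x
                           in Sum.map (suc k ,_) (suc k ,_) (extendAll-decides (stage k) x∈)
        }

    lindenbaum : ∀ {A} → FinitelySatisfiable A → Σ Theory λ w → IsMaximal w × A ⊆ w
    lindenbaum {A} fsA = limit , limit-isMaximal , (0 ,_)
      where open Lindenbaum A fsA

    unboxed : Theory → Theory
    unboxed v x = v (□ x)

    -- A state realising ¬□φ and every □ψ with ψ ∈ l′ has □(⋀ l′) by the filter laws, so
    -- not every state satisfying ⋀ l′ satisfies φ.
    successor-finSat : ∀ {v φ} → IsMaximal v → v (¬ₘ □ φ) →
                       FinitelySatisfiable (insert (¬ₘ φ) (unboxed v))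
    successor-finSat {v} {φ} mv v¬□φ l al with split-insert l al
    ... | l′ , vl′ , back with finSat mv (¬ₘ □ φ ∷ map □_ l′) (v¬□φ ∷ map⁺ vl′)
    ... | s , ¬□φ ∷ □l′ =
      dne λ unsat → ¬□φ (□-mono (λ {t} tl′ → dne λ ¬tφ → unsat (t , back t tl′ ¬tφ))
                                (□-all l′ (map⁻ □l′)))

    successor : ∀ {v φ} → IsMaximal v → v (¬ₘ □ φ) →
                Σ Theory λ u → IsMaximal u × unboxed v ⊆ u × u (¬ₘ φ)
    successor mv v¬□φ =
      let u , mu , ⊆u = lindenbaum (successor-finSat mv v¬□φ)
      in u , mu , ⊆u ∘ inj₁ , ⊆u (inj₂ refl)

    -- Worlds are Bool-valued so that the canonical model lives in Set.
    World : Set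
    World = Σ (ModalForm → Bool) λ b → IsMaximal (T ∘ b)

    ⟨_⟩ : World → Theory
    ⟨ b , _ ⟩ x = T (b x)

    world : ∀ {w} → IsMaximal w → World
    world {w} mw = decide w , isMaximal-≐ (≐-sym (T-decide w)) mw

    canonical : KripkeModel
    canonical = record
      { S = World
      ; R = λ v u → unboxed ⟨ v ⟩ ⊆ ⟨ u ⟩
      ; V = λ p w → ⟨ w ⟩ (atom p) }

    module C = FilterModel (relational canonical)

    ⟨world⟩ : ∀ {w} (mw : IsMaximal w) → ⟨ world mw ⟩ ≐ w
    ⟨world⟩ {w} _ = T-decide w

    truth-□ : ∀ {x} → (∀ u → C.msat u x ⇔ ⟨ u ⟩ x) → ∀ w → C.msat w (□ x) ⇔ ⟨ w ⟩ (□ x)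
    truth-□ {x} IH w = mk⇔ □⇒ (λ w□x u wRu → from (IH u) (wRu w□x))
      where
      □⇒ : C.msat w (□ x) → ⟨ w ⟩ (□ x)
      □⇒ □x with complete (proj₂ w) (□ x)
      ... | inj₁ w□x  = w□x
      ... | inj₂ w¬□x with successor (proj₂ w) w¬□x
      ... | u , mu , ⊆u , u¬x =
        let wRu : unboxed ⟨ w ⟩ ⊆ ⟨ world mu ⟩
            wRu = proj₂ (⟨world⟩ mu) ∘ ⊆u
            ux = proj₁ (⟨world⟩ mu) (to (IH (world mu)) (□x (world mu) wRu))
        in ⊥-elim (¬-both mu ux u¬x)

    truth : ∀ w x → C.msat w x ⇔ ⟨ w ⟩ x
    truth w (atom p) = ⇔-id _
    truth w (¬ₘ x)   = ¬⇔¬ₘ (proj₂ w) ⇔-∘ ¬-cong (truth w x)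
    truth w (x ∧ₘ y) = ×⇔∧ₘ (proj₂ w) ⇔-∘ (truth w x ×-⇔ truth w y)
    truth w (□ x)    = truth-□ (λ u → truth u x) w

    theory-isMaximal : ∀ s → IsMaximal (msat s)
    theory-isMaximal s = record
      { finSat = λ l sl → s , sl
      ; complete = λ x → toSum (em {msat s x}) }

    root : S → World
    root s = world (theory-isMaximal s)

    msat⇔root : ∀ s x → msat s x ⇔ C.msat (root s) x
    msat⇔root s x = ⇔-sym (truth (root s) x) ⇔-∘ mk⇔ (proj₂ root≐ {x}) (proj₁ root≐ {x})
      where
      root≐ : ⟨ root s ⟩ ≐ msat s
      root≐ = ⟨world⟩ (theory-isMaximal s)

  ⊩qf⇒⊨ : ∀ {Γ φ} → Γ ⊩qf φ → Γ ⊨ φ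
  ⊩qf⇒⊨ {φ = φ} Γ⊩φ K s sΓ =
    from (ksat⇔nsat K s φ)
         (Γ⊩φ (kripkeNbhd K) (kripkeNbhd-isQuasiFilter K) s λ ψ γ → to (ksat⇔nsat K s ψ) (sΓ ψ γ))

  module _ (M : NbhdModel) (qf : IsQuasiFilter M) where
    open Core M qf using (core; nsat⇔msat)
    open Canonical core using (canonical; root; msat⇔root)

    nsat⇔ksat-canonical : ∀ s φ → nsat M s φ ⇔ ksat canonical (root s) φ
    nsat⇔ksat-canonical s φ = begin
      nsat M s φ                                    ≈⟨ nsat⇔msat s φ ⟩
      FilterModel.msat core s (toModal φ)           ≈⟨ msat⇔root s (toModal φ) ⟩
      FilterModel.msat (relational canonical) (root s) (toModal φ)
                                                    ≈⟨ ksat⇔msat canonical (root s) φ ⟨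
      ksat canonical (root s) φ                     ∎

  ⊨⇒⊩qf : ∀ {Γ φ} → Γ ⊨ φ → Γ ⊩qf φ
  ⊨⇒⊩qf {φ = φ} Γ⊨φ M qf s sΓ =
    from (nsat⇔ksat-canonical M qf s φ)
         (Γ⊨φ canonical (root s) λ ψ γ → to (nsat⇔ksat-canonical M qf s ψ) (sΓ ψ γ))
    where open Canonical (Core.core M qf) using (canonical; root)

  ⊩qf⇔⊨ : (Γ : Form → Set) (φ : Form) → (Γ ⊩qf φ) ⇔ (Γ ⊨ φ)
  ⊩qf⇔⊨ Γ φ = mk⇔ (⊩qf⇒⊨ {Γ} {φ}) (⊨⇒⊩qf {Γ} {φ})

corollary5 : ExcludedMiddle 0ℓ →
    ((Γ : Form → Set) (φ : Form) → (Γ ⊩qf φ) ⇔ (Γ ⊨ φ))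
    × ((φ : Form) → (∅ ⊩qf φ) ⇔ (∅ ⊨ φ))
corollary5 em = ⊩qf⇔⊨ , ⊩qf⇔⊨ ∅
  where open Classical em
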